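{- Let $n \geq 1$, let $\mathbb{F}$ be a field, and let $I_n \subseteq \mathbb{F}[\mathbf{x}_{n\times n}]$ be the ideal defined in the context. For subsets $S, T \subseteq [n]$ define $$a_{S,T} := \sum_{f: S \hookrightarrow T} \prod_{i \in S} x_{i,f(i)}, \qquad b_{S,T} := \sum_{f: S \hookrightarrow T} \prod_{i \in S} x_{f(i),i},$$ where both sums range over injective functions $f: S \to T$. If $|S| + |T| > n$, then $a_{S,T} \in I_n$ and $b_{S,T} \in I_n$.
   Context: $[n] = \{1,\dots,n\}$. $\mathbb{F}[\mathbf{x}_{n\times n}]$ is the polynomial ring over $\mathbb{F}$ in the $n^2$ variables $x_{i,j}$, $1 \le i,j \le n$. $I_n$ is the ideal generated by: all products $x_{i,j}x_{i,j'}$ ($1\le i,j,j'\le n$, including $j=j'$); all products $x_{i,j}x_{i',j}$ ($1 \le i,i',j \le n$); all row sums $x_{i,1}+\cdots+x_{i,n}$ ($1\le i\le n$); and all column sums $x_{1,j}+\cdots+x_{n,j}$ ($1 \le j \le n$). -}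

module Defs where

open import Level using (Level; _⊔_; suc)
open import Algebra.Bundles using (CommutativeRing)
open import Data.Nat using (ℕ)
open import Data.Fin using (Fin)
open import Data.Fin.Properties using () renaming (_≟_ to _≟F_)
open import Data.Fin.Subset using (Subset)
open import Data.Fin.Subset.Properties using (_∈?_)
open import Data.List using (List; []; _∷_; [_]; map; concatMap; filter; foldr; allFin)
open import Data.Product using (_×_; _,_; proj₁; proj₂; Σ)
open import Relation.Nullary using (¬_)
import Data.List.Relation.Unary.Unique.DecPropositional as UniqueDec

record IsField {c ℓ : Level} (R : CommutativeRing c ℓ) : Set (c ⊔ ℓ) where
  open CommutativeRing R using (Carrier; _≈_; _+_; _*_; -_; 0#; 1#)
  field
    0≉1      : ¬ (0# ≈ 1#)
    inverse  : ∀ x → ¬ (x ≈ 0#) → Σ Carrier λ y → (x * y) ≈ 1#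

data Expr {c : Level} (A : Set c) (V : Set) : Set c where
  var  : V → Expr A V
  con  : A → Expr A V
  _⊕_  : Expr A V → Expr A V → Expr A V
  _⊗_  : Expr A V → Expr A V → Expr A V
  ⊖_   : Expr A V → Expr A V

infixl 6 _⊕_
infixl 7 _⊗_

module Poly {c ℓ : Level} (R : CommutativeRing c ℓ) (V : Set) where
  open CommutativeRing R using (Carrier; _≈_; _+_; _*_; -_; 0#; 1#)

  P : Set c
  P = Expr Carrier V

  -- Equality in the polynomial ring R[V]: the congruence generated by the
  -- commutative ring axioms and by 'con' being a ring homomorphism R → R[V].
  -- The quotient P / _≈P_ is exactly R[V].
  infix 4 _≈P_
  data _≈P_ : P → P → Set (c ⊔ ℓ) where
    reflP   : ∀ {p} → p ≈P p
    symP    : ∀ {p q} → p ≈P q → q ≈P p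
    transP  : ∀ {p q r} → p ≈P q → q ≈P r → p ≈P r
    ⊕-cong  : ∀ {p p' q q'} → p ≈P p' → q ≈P q' → p ⊕ q ≈P p' ⊕ q'
    ⊗-cong  : ∀ {p p' q q'} → p ≈P p' → q ≈P q' → p ⊗ q ≈P p' ⊗ q'
    ⊖-cong  : ∀ {p p'} → p ≈P p' → ⊖ p ≈P ⊖ p'
    ⊕-assoc : ∀ p q r → (p ⊕ q) ⊕ r ≈P p ⊕ (q ⊕ r)
    ⊕-comm  : ∀ p q → p ⊕ q ≈P q ⊕ p
    ⊕-idˡ   : ∀ p → con 0# ⊕ p ≈P p
    ⊖-invˡ  : ∀ p → (⊖ p) ⊕ p ≈P con 0#
    ⊗-assoc : ∀ p q r → (p ⊗ q) ⊗ r ≈P p ⊗ (q ⊗ r)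
    ⊗-comm  : ∀ p q → p ⊗ q ≈P q ⊗ p
    ⊗-idˡ   : ∀ p → con 1# ⊗ p ≈P p
    ⊗-distribˡ : ∀ p q r → p ⊗ (q ⊕ r) ≈P (p ⊗ q) ⊕ (p ⊗ r)
    con-cong : ∀ {a b} → a ≈ b → con a ≈P con b
    con-+   : ∀ a b → con (a + b) ≈P con a ⊕ con b
    con-*   : ∀ a b → con (a * b) ≈P con a ⊗ con b
    con--   : ∀ a → con (- a) ≈P ⊖ con a

  data InIdeal {g : Level} (G : P → Set g) : P → Set (c ⊔ ℓ ⊔ g) where
    ideal-0   : InIdeal G (con 0#)
    ideal-gen : ∀ {q} → G q → (h : P) → InIdeal G (h ⊗ q)
    ideal-+   : ∀ {p q} → InIdeal G p → InIdeal G q → InIdeal G (p ⊕ q)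
    ideal-≈   : ∀ {p q} → p ≈P q → InIdeal G p → InIdeal G q

  sumL : List P → P
  sumL = foldr _⊕_ (con 0#)

  prodL : List P → P
  prodL = foldr _⊗_ (con 1#)

-- The n×n setting: variables x_{i,j}, i,j ∈ [n] (Fin n, 0-indexed).
module Matrix {c ℓ : Level} (R : CommutativeRing c ℓ) (n : ℕ) where
  open CommutativeRing R using (Carrier)
  open Poly R (Fin n × Fin n) public

  x : Fin n → Fin n → P
  x i j = var (i , j)

  sumFin : (Fin n → P) → P
  sumFin f = sumL (map f (allFin n))

  data Gen : P → Set c where
    rowProd : ∀ i j j' → Gen (x i j ⊗ x i j')
    colProd : ∀ i i' j → Gen (x i j ⊗ x i' j)
    rowSum  : ∀ i → Gen (sumFin (λ j → x i j))
    colSum  : ∀ j → Gen (sumFin (λ i → x i j))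

  _∈I : P → Set (c ⊔ ℓ)
  p ∈I = InIdeal Gen p

  elems : Subset n → List (Fin n)
  elems S = filter (_∈? S) (allFin n)

  -- all functions from a list of domain points D into a list of codomain
  -- points T, each represented by its graph [(d₁ , f d₁) , … ]
  funcs : List (Fin n) → List (Fin n) → List (List (Fin n × Fin n))
  funcs [] T = [ [] ]
  funcs (d ∷ D) T = concatMap (λ t → map ((d , t) ∷_) (funcs D T)) T

  open UniqueDec (_≟F_ {n}) using (unique?)

  injections : Subset n → Subset n → List (List (Fin n × Fin n))
  injections S T = filter (λ g → unique? (map proj₂ g)) (funcs (elems S) (elems T))

  a : Subset n → Subset n → P
  a S T = sumL (map (λ g → prodL (map (λ { (i , fi) → x i fi }) g)) (injections S T))

  b : Subset n → Subset n → P
  b S T = sumL (map (λ g → prodL (map (λ { (i , fi) → x fi i }) g)) (injections S T))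

{-# OPTIONS --safe #-}
module Submission where

-- In R[x]/I_n the relations x_ij x_i'j = 0 kill every term of the expansion of
-- Π_{i∈S} Σ_{j∈T} x_ij that comes from a non-injective f : S → T, so a_{S,T} equals
-- this product. The row sums turn each factor into -Σ_{j∉T} x_ij, and expanding
-- Π_{i∈S} Σ_{j∉T} (-x_ij) produces only non-injective terms, since |S| > n - |T|.
-- So a_{S,T} = 0 in R[x]/I_n; for b_{S,T} apply the same to the transposed matrix.

open import Defs
open import Level using (Level; _⊔_)
open import Algebra.Bundles using (CommutativeRing)
import Algebra.Consequences.Setoid as Consequences
import Algebra.Properties.Ring as RingProperties
import Algebra.Properties.CommutativeSemigroup as CommutativeSemigroupProperties
open import Data.Nat using (ℕ; suc; _≤_; _<_; _≥_; _>_; z≤n; s≤s)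
import Data.Nat as ℕ
open import Data.Nat.Properties using (<-≤-trans; <⇒≱; +-cancelʳ-<; m∸n+n≡m)
open import Data.Fin using (Fin; zero; suc; _≟_)
open import Data.Fin.Subset using (Subset; ∣_∣; _∈_; ∁; inside; outside)
import Data.Fin.Subset as Subset
open import Data.Fin.Subset.Properties
  using (_∈?_; x∉p⇒x∈∁p; x∈∁p⇒x∉p; x∈p⇒∣p-x∣<∣p∣; x∈p∧x∉q⇒x∈p─q; x∈⁅y⁆⇒x≡y; drop-there; ∣∁p∣≡n∸∣p∣; ∣p∣≤n)
import Data.Vec as Vec
open import Data.Product using (_×_; _,_; Σ; proj₂; uncurry)
open import Data.List using (List; []; _∷_; foldr; map; filter; concatMap; _++_; length; tabulate; allFin)
open import Data.List.Relation.Unary.All as All using (All; []; _∷_)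
open import Data.List.Relation.Unary.All.Properties using (map⁺; concat⁺; all-filter; ¬Any⇒All¬)
open import Data.List.Properties using (length-map; map-∘; filter-≐)
open import Data.List.Relation.Unary.Unique.Propositional using (Unique; []; _∷_)
open import Data.List.Relation.Unary.Any using (here; there; any?)
open import Data.List.Membership.Propositional.Properties using (∈-map⁺; ∈-map⁻)
import Data.List.Relation.Unary.Unique.DecPropositional as UniqueDec
open import Data.List.Membership.Propositional using () renaming (_∈_ to _∈ˡ_)
open import Function using (_∘_)
open import Relation.Nullary using (¬_; yes; no; ¬?; contradiction)
open import Relation.Unary using (Pred; Decidable)
import Relation.Binary.PropositionalEquality as ≡
open import Relation.Binary.Bundles using (Setoid)
import Relation.Binary.Reasoning.Setoid as SetoidReasoning

module PolynomialRing {c ℓ} (R : CommutativeRing c ℓ) (V : Set) where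
  open Poly R V
  open CommutativeRing R using (0#; 1#)

  ≈P-setoid : Setoid c (c ⊔ ℓ)
  ≈P-setoid = record
    { Carrier = P ; _≈_ = _≈P_
    ; isEquivalence = record { refl = reflP ; sym = symP ; trans = transP } }

  open Consequences ≈P-setoid

  polynomialRing : CommutativeRing c (c ⊔ ℓ)
  polynomialRing = record
    { Carrier = P ; _≈_ = _≈P_ ; _+_ = _⊕_ ; _*_ = _⊗_ ; -_ = ⊖_ ; 0# = con 0# ; 1# = con 1#
    ; isCommutativeRing = record
      { isRing = record
        { +-isAbelianGroup = record
          { isGroup = record
            { isMonoid = record
              { isSemigroup = record
                { isMagma = record { isEquivalence = Setoid.isEquivalence ≈P-setoid ; ∙-cong = ⊕-cong }
                ; assoc = ⊕-assoc }
              ; identity = comm∧idˡ⇒id ⊕-comm ⊕-idˡ }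
            ; inverse = comm∧invˡ⇒inv ⊕-comm ⊖-invˡ
            ; ⁻¹-cong = ⊖-cong }
          ; comm = ⊕-comm }
        ; *-cong = ⊗-cong
        ; *-assoc = ⊗-assoc
        ; *-identity = comm∧idˡ⇒id ⊗-comm ⊗-idˡ
        ; distrib = ⊗-distribˡ , comm∧distrˡ⇒distrʳ ⊕-cong ⊗-comm ⊗-distribˡ }
      ; *-comm = ⊗-comm } }

module QuotientRing {c ℓ g} (R : CommutativeRing c ℓ) (V : Set) (G : Poly.P R V → Set g) where
  open Poly R V using (P; InIdeal; ideal-0; ideal-gen; ideal-+; ideal-≈)
  open PolynomialRing R V using (polynomialRing)
  open CommutativeRing polynomialRing
  open RingProperties ring
  open CommutativeSemigroupProperties +-commutativeSemigroup using (interchange)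
  open SetoidReasoning setoid

  InIdeal-*ˡ : ∀ h {p} → InIdeal G p → InIdeal G (h * p)
  InIdeal-*ˡ h ideal-0 = ideal-≈ (sym (zeroʳ h)) ideal-0
  InIdeal-*ˡ h (ideal-gen {q} q∈G h') = ideal-≈ (*-assoc h h' q) (ideal-gen q∈G (h * h'))
  InIdeal-*ˡ h (ideal-+ {p} {q} p∈ q∈) =
    ideal-≈ (sym (distribˡ h p q)) (ideal-+ (InIdeal-*ˡ h p∈) (InIdeal-*ˡ h q∈))
  InIdeal-*ˡ h (ideal-≈ p≈q p∈) = ideal-≈ (*-congˡ p≈q) (InIdeal-*ˡ h p∈)

  InIdeal-generator : ∀ {p} → G p → InIdeal G p
  InIdeal-generator {p} p∈G = ideal-≈ (*-identityˡ p) (ideal-gen p∈G 1#)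

  InIdeal-*ʳ : ∀ h {p} → InIdeal G p → InIdeal G (p * h)
  InIdeal-*ʳ h {p} p∈ = ideal-≈ (*-comm h p) (InIdeal-*ˡ h p∈)

  InIdeal-neg : ∀ {p} → InIdeal G p → InIdeal G (- p)
  InIdeal-neg {p} p∈ = ideal-≈ (-1*x≈-x p) (InIdeal-*ˡ (- 1#) p∈)

  infix 4 _≈I_
  _≈I_ : P → P → Set (c ⊔ ℓ ⊔ g)
  p ≈I q = InIdeal G (p - q)

  ≈⇒≈I : ∀ {p q} → p ≈ q → p ≈I q
  ≈⇒≈I p≈q = ideal-≈ (sym (x≈y⇒x∙y⁻¹≈ε p≈q)) ideal-0

  ≈I-sym : ∀ {p q} → p ≈I q → q ≈I p
  ≈I-sym {p} {q} p≈Iq = ideal-≈ (⁻¹-anti-homo‿- p q) (InIdeal-neg p≈Iq)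

  -‿telescope : ∀ p q r → (p - q) + (q - r) ≈ p - r
  -‿telescope p q r = begin
    (p - q) + (q - r)     ≈⟨ +-assoc p (- q) (q - r) ⟩
    p + (- q + (q - r))   ≈⟨ +-congˡ (+-assoc (- q) q (- r)) ⟨
    p + ((- q + q) - r)   ≈⟨ +-congˡ (+-congʳ (-‿inverseˡ q)) ⟩
    p + (0# - r)          ≈⟨ +-congˡ (+-identityˡ (- r)) ⟩
    p - r                 ∎

  ≈I-trans : ∀ {p q r} → p ≈I q → q ≈I r → p ≈I r
  ≈I-trans {p} {q} {r} p≈Iq q≈Ir = ideal-≈ (-‿telescope p q r) (ideal-+ p≈Iq q≈Ir)

  +-congI : ∀ {p p' q q'} → p ≈I p' → q ≈I q' → p + q ≈I p' + q'
  +-congI {p} {p'} {q} {q'} p≈Ip' q≈Iq' = ideal-≈ difference (ideal-+ p≈Ip' q≈Iq')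
    where
    difference : (p - p') + (q - q') ≈ (p + q) - (p' + q')
    difference = begin
      (p - p') + (q - q')   ≈⟨ interchange p (- p') q (- q') ⟩
      (p + q) + (- p' - q') ≈⟨ +-congˡ (-‿+-comm p' q') ⟩
      (p + q) - (p' + q')   ∎

  *-congI : ∀ {p p' q q'} → p ≈I p' → q ≈I q' → p * q ≈I p' * q'
  *-congI {p} {p'} {q} {q'} p≈Ip' q≈Iq' =
    ideal-≈ difference (ideal-+ (InIdeal-*ˡ p q≈Iq') (InIdeal-*ʳ q' p≈Ip'))
    where
    difference : p * (q - q') + (p - p') * q' ≈ p * q - p' * q'
    difference = begin
      p * (q - q') + (p - p') * q'            ≈⟨ +-cong (x[y-z]≈xy-xz p q q') ([y-z]x≈yx-zx q' p p') ⟩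
      (p * q - p * q') + (p * q' - p' * q')   ≈⟨ -‿telescope (p * q) (p * q') (p' * q') ⟩
      p * q - p' * q'                         ∎

  -‿congI : ∀ {p p'} → p ≈I p' → - p ≈I - p'
  -‿congI {p} {p'} p≈Ip' = ideal-≈ (sym (-‿+-comm p (- p'))) (InIdeal-neg p≈Ip')

  quotientRing : CommutativeRing c (c ⊔ ℓ ⊔ g)
  quotientRing = record
    { Carrier = P ; _≈_ = _≈I_ ; _+_ = _+_ ; _*_ = _*_ ; -_ = -_ ; 0# = 0# ; 1# = 1#
    ; isCommutativeRing = record
      { isRing = record
        { +-isAbelianGroup = record
          { isGroup = record
            { isMonoid = record
              { isSemigroup = record
                { isMagma = record
                  { isEquivalence = record { refl = ≈⇒≈I refl ; sym = ≈I-sym ; trans = ≈I-trans }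
                  ; ∙-cong = +-congI }
                ; assoc = λ p q r → ≈⇒≈I (+-assoc p q r) }
              ; identity = (λ p → ≈⇒≈I (+-identityˡ p)) , (λ p → ≈⇒≈I (+-identityʳ p)) }
            ; inverse = (λ p → ≈⇒≈I (-‿inverseˡ p)) , (λ p → ≈⇒≈I (-‿inverseʳ p))
            ; ⁻¹-cong = -‿congI }
          ; comm = λ p q → ≈⇒≈I (+-comm p q) }
        ; *-cong = *-congI
        ; *-assoc = λ p q r → ≈⇒≈I (*-assoc p q r)
        ; *-identity = (λ p → ≈⇒≈I (*-identityˡ p)) , (λ p → ≈⇒≈I (*-identityʳ p))
        ; distrib = (λ p q r → ≈⇒≈I (distribˡ p q r)) , (λ p q r → ≈⇒≈I (distribʳ p q r)) }
      ; *-comm = λ p q → ≈⇒≈I (*-comm p q) } }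

  x-0#≈x : ∀ {p} → p - 0# ≈ p
  x-0#≈x {p} = trans (+-congˡ -0#≈0#) (+-identityʳ p)

  InIdeal⇒≈I0 : ∀ {p} → InIdeal G p → p ≈I 0#
  InIdeal⇒≈I0 = ideal-≈ (sym x-0#≈x)

  ≈I0⇒InIdeal : ∀ {p} → p ≈I 0# → InIdeal G p
  ≈I0⇒InIdeal = ideal-≈ x-0#≈x

module ListSums {a ℓa} (A : CommutativeRing a ℓa) where
  open CommutativeRing A
  open RingProperties ring using (-0#≈0#; -‿+-comm)
  open CommutativeSemigroupProperties +-commutativeSemigroup using (x∙yz≈y∙xz)
  open CommutativeSemigroupProperties *-commutativeSemigroup using () renaming (x∙yz≈y∙xz to x*yz≈y*xz)

  sum : List Carrier → Carrier
  sum = foldr _+_ 0#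

  prod : List Carrier → Carrier
  prod = foldr _*_ 1#

  module _ {X : Set} where

    sum-++ : (f : X → Carrier) (xs ys : List X) → sum (map f (xs ++ ys)) ≈ sum (map f xs) + sum (map f ys)
    sum-++ f [] ys = sym (+-identityˡ _)
    sum-++ f (x ∷ xs) ys = trans (+-congˡ (sum-++ f xs ys)) (sym (+-assoc _ _ _))

    *-distribˡ-sum : ∀ y (f : X → Carrier) xs → y * sum (map f xs) ≈ sum (map (λ x → y * f x) xs)
    *-distribˡ-sum y f [] = zeroʳ y
    *-distribˡ-sum y f (x ∷ xs) = trans (distribˡ _ _ _) (+-congˡ (*-distribˡ-sum y f xs))

    *-distribʳ-sum : ∀ y (f : X → Carrier) xs → sum (map f xs) * y ≈ sum (map (λ x → f x * y) xs)
    *-distribʳ-sum y f [] = zeroˡ y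
    *-distribʳ-sum y f (x ∷ xs) = trans (distribʳ _ _ _) (+-congˡ (*-distribʳ-sum y f xs))

    -‿sum : (f : X → Carrier) (xs : List X) → - sum (map f xs) ≈ sum (map (λ x → - f x) xs)
    -‿sum f [] = -0#≈0#
    -‿sum f (x ∷ xs) = trans (sym (-‿+-comm _ _)) (+-congˡ (-‿sum f xs))

    sum-≈0 : (f : X → Carrier) {xs : List X} → All (λ x → f x ≈ 0#) xs → sum (map f xs) ≈ 0#
    sum-≈0 f [] = refl
    sum-≈0 f (fx≈0 ∷ fxs≈0) = trans (+-cong fx≈0 (sum-≈0 f fxs≈0)) (+-identityˡ 0#)

    sum-partition : ∀ {ℓq} {Q : Pred X ℓq} (Q? : Decidable Q) (f : X → Carrier) (xs : List X) →
                    sum (map f xs) ≈ sum (map f (filter Q? xs)) + sum (map f (filter (¬? ∘ Q?) xs))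
    sum-partition Q? f [] = sym (+-identityˡ 0#)
    sum-partition Q? f (x ∷ xs) with Q? x
    ... | yes _ = trans (+-congˡ (sum-partition Q? f xs)) (sym (+-assoc _ _ _))
    ... | no  _ = trans (+-congˡ (sum-partition Q? f xs)) (x∙yz≈y∙xz _ _ _)

    sum-cong : {f g : X → Carrier} → (∀ x → f x ≈ g x) → (xs : List X) → sum (map f xs) ≈ sum (map g xs)
    sum-cong f≈g [] = refl
    sum-cong f≈g (x ∷ xs) = +-cong (f≈g x) (sum-cong f≈g xs)

    prod-cong : {f g : X → Carrier} → (∀ x → f x ≈ g x) → (xs : List X) → prod (map f xs) ≈ prod (map g xs)
    prod-cong f≈g [] = refl
    prod-cong f≈g (x ∷ xs) = *-cong (f≈g x) (prod-cong f≈g xs)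

  sum-concatMap : {X Y : Set} (f : Y → Carrier) (h : X → List Y) (xs : List X) →
                  sum (map f (concatMap h xs)) ≈ sum (map (λ x → sum (map f (h x))) xs)
  sum-concatMap f h [] = refl
  sum-concatMap f h (x ∷ xs) = trans (sum-++ f (h x) (concatMap h xs)) (+-congˡ (sum-concatMap f h xs))

  prod-∈ : ∀ {x xs} → x ∈ˡ xs → Σ Carrier λ r → prod xs ≈ x * r
  prod-∈ {xs = _ ∷ xs} (here ≡.refl) = prod xs , refl
  prod-∈ {xs = y ∷ _} (there x∈xs) with r , prod≈x*r ← prod-∈ x∈xs =
    y * r , trans (*-congˡ prod≈x*r) (x*yz≈y*xz y _ r)

length-filter-tabulate : ∀ {m n} (p : Subset m) (q : Subset n) (f : Fin m → Fin n) →
                         (∀ i → f i ∈ q → i ∈ p) → (∀ i → i ∈ p → f i ∈ q) →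
                         length (filter (_∈? q) (tabulate f)) ≡.≡ ∣ p ∣
length-filter-tabulate Vec.[] q f _ _ = ≡.refl
length-filter-tabulate (inside Vec.∷ p) q f f⁻¹q⊆p p⊆f⁻¹q with f zero ∈? q
... | yes _   = ≡.cong suc (length-filter-tabulate p q (f ∘ suc) (λ i → drop-there ∘ f⁻¹q⊆p (suc i))
                                                                (λ i → p⊆f⁻¹q (suc i) ∘ Vec.there))
... | no f0∉q = contradiction (p⊆f⁻¹q zero Vec.here) f0∉q
length-filter-tabulate (outside Vec.∷ p) q f f⁻¹q⊆p p⊆f⁻¹q with f zero ∈? q
... | yes f0∈q with () ← f⁻¹q⊆p zero f0∈q
... | no _     = length-filter-tabulate p q (f ∘ suc) (λ i → drop-there ∘ f⁻¹q⊆p (suc i))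
                                                      (λ i → p⊆f⁻¹q (suc i) ∘ Vec.there)

Unique⇒length≤∣∣ : ∀ {n} (C : Subset n) {xs : List (Fin n)} → Unique xs → All (_∈ C) xs → length xs ≤ ∣ C ∣
Unique⇒length≤∣∣ C [] [] = z≤n
Unique⇒length≤∣∣ C {x ∷ xs} (x≢xs ∷ xs-unique) (x∈C ∷ xs⊆C) =
  <-≤-trans (s≤s (Unique⇒length≤∣∣ (C Subset.- x) xs-unique xs⊆C-x)) (x∈p⇒∣p-x∣<∣p∣ x∈C)
  where
  xs⊆C-x : All (_∈ C Subset.- x) xs
  xs⊆C-x = All.zipWith (λ (x≢y , y∈C) → x∈p∧x∉q⇒x∈p─q y∈C (x≢y ∘ ≡.sym ∘ x∈⁅y⁆⇒x≡y x)) (x≢xs , xs⊆C)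

∣∁q∣<∣p∣ : ∀ {n} (p q : Subset n) → ∣ p ∣ ℕ.+ ∣ q ∣ > n → ∣ ∁ q ∣ < ∣ p ∣
∣∁q∣<∣p∣ {n} p q n<∣p∣+∣q∣ =
  +-cancelʳ-< (∣ q ∣) (∣ ∁ q ∣) (∣ p ∣) (≡.subst (_< ∣ p ∣ ℕ.+ ∣ q ∣) (≡.sym ∣∁q∣+∣q∣≡n) n<∣p∣+∣q∣)
  where
  ∣∁q∣+∣q∣≡n : ∣ ∁ q ∣ ℕ.+ ∣ q ∣ ≡.≡ n
  ∣∁q∣+∣q∣≡n = ≡.trans (≡.cong (ℕ._+ ∣ q ∣) (∣∁p∣≡n∸∣p∣ q)) (m∸n+n≡m (∣p∣≤n q))

-- Matrix R n is opened only for its index lists elems, funcs and injections,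
-- which do not depend on the coefficient ring R.
module Injections {c ℓ} (R : CommutativeRing c ℓ) (n : ℕ) where
  open Matrix R n using (elems; funcs; injections)

  funcs-graph : ∀ {q} (Q : Pred (Fin n) q) D L → All Q L →
                All (λ g → length g ≡.≡ length D × All (Q ∘ proj₂) g) (funcs D L)
  funcs-graph Q [] L _ = (≡.refl , []) ∷ []
  funcs-graph Q (d ∷ D) L QL = concat⁺ (map⁺ (All.map (λ Qt → map⁺ (All.map (extend Qt) (funcs-graph Q D L QL))) QL))
    where
    extend : ∀ {t g} → Q t → length g ≡.≡ length D × All (Q ∘ proj₂) g →
             length ((d , t) ∷ g) ≡.≡ length (d ∷ D) × All (Q ∘ proj₂) ((d , t) ∷ g)
    extend Qt (len≡ , Qg) = ≡.cong suc len≡ , Qt ∷ Qg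

  funcs-non-injective : (S C : Subset n) → ∣ C ∣ < ∣ S ∣ →
                        All (λ g → ¬ Unique (map proj₂ g)) (funcs (elems S) (elems C))
  funcs-non-injective S C ∣C∣<∣S∣ =
    All.map pigeonhole (funcs-graph (_∈ C) (elems S) (elems C) (all-filter (_∈? C) (allFin n)))
    where
    pigeonhole : ∀ {g} → length g ≡.≡ length (elems S) × All ((_∈ C) ∘ proj₂) g → ¬ Unique (map proj₂ g)
    pigeonhole {g} (len≡ , g⊆C) unique = <⇒≱ ∣C∣<∣S∣ (begin
      ∣ S ∣                 ≡⟨ length-filter-tabulate S S (λ i → i) (λ _ i∈S → i∈S) (λ _ i∈S → i∈S) ⟨
      length (elems S)      ≡⟨ len≡ ⟨
      length g              ≡⟨ length-map proj₂ g ⟨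
      length (map proj₂ g)  ≤⟨ Unique⇒length≤∣∣ C unique (map⁺ g⊆C) ⟩
      ∣ C ∣                 ∎)
      where open Data.Nat.Properties.≤-Reasoning

  module _ {a ℓa} (A : CommutativeRing a ℓa) where
    open CommutativeRing A
    open ListSums A
    open RingProperties ring using (-‿distribˡ-*; -‿distribʳ-*; -‿involutive; +-inverseˡ-unique)
    open UniqueDec (_≟_ {n}) using (unique?)
    open SetoidReasoning setoid

    term : (Fin n → Fin n → Carrier) → List (Fin n × Fin n) → Carrier
    term z g = prod (map (uncurry z) g)

    prod-sum≈sum-funcs : (z : Fin n → Fin n → Carrier) (D L : List (Fin n)) →
                         prod (map (λ d → sum (map (z d) L)) D) ≈ sum (map (term z) (funcs D L))
    prod-sum≈sum-funcs z [] L = sym (+-identityʳ 1#)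
    prod-sum≈sum-funcs z (d ∷ D) L = begin
      sum (map (z d) L) * prod (map (λ d → sum (map (z d) L)) D) ≈⟨ *-congˡ (prod-sum≈sum-funcs z D L) ⟩
      sum (map (z d) L) * sum (map (term z) F)                    ≈⟨ *-distribʳ-sum _ (z d) L ⟩
      sum (map (λ t → z d t * sum (map (term z) F)) L)             ≈⟨ sum-cong (λ t → *-distribˡ-sum (z d t) (term z) F) L ⟩
      sum (map (λ t → sum (map (λ g → z d t * term z g) F)) L)     ≈⟨ sum-cong (λ t → reflexive (≡.cong sum (map-∘ F))) L ⟩
      sum (map (λ t → sum (map (term z) (map ((d , t) ∷_) F))) L)  ≈⟨ sum-concatMap (term z) (λ t → map ((d , t) ∷_) F) L ⟨
      sum (map (term z) (funcs (d ∷ D) L))                         ∎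
      where F = funcs D L

    term≈0-if-non-injective : (z : Fin n → Fin n → Carrier) → (∀ i i' j → z i j * z i' j ≈ 0#) →
                              ∀ g → ¬ Unique (map proj₂ g) → term z g ≈ 0#
    term≈0-if-non-injective z col [] non-injective = contradiction [] non-injective
    term≈0-if-non-injective z col ((i , j) ∷ g) non-injective with any? (j ≟_) (map proj₂ g)
    ... | yes j∈g with (i' , _) , ij'∈g , ≡.refl ← ∈-map⁻ proj₂ j∈g
                  with r , term≈zi'j*r ← prod-∈ (∈-map⁺ (uncurry z) ij'∈g) = begin
      z i j * term z g           ≈⟨ *-congˡ term≈zi'j*r ⟩
      z i j * (z i' j * r)       ≈⟨ *-assoc _ _ _ ⟨
      (z i j * z i' j) * r       ≈⟨ *-congʳ (col i i' j) ⟩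
      0# * r                     ≈⟨ zeroˡ r ⟩
      0#                         ∎
    ... | no j∉g = begin
      z i j * term z g           ≈⟨ *-congˡ (term≈0-if-non-injective z col g g-non-injective) ⟩
      z i j * 0#                 ≈⟨ zeroʳ _ ⟩
      0#                         ∎
      where
      g-non-injective : ¬ Unique (map proj₂ g)
      g-non-injective = non-injective ∘ (¬Any⇒All¬ _ j∉g ∷_)

    sum-injections≈sum-funcs : (z : Fin n → Fin n → Carrier) → (∀ i i' j → z i j * z i' j ≈ 0#) →
                               (S T : Subset n) → sum (map (term z) (injections S T)) ≈
                                                  sum (map (term z) (funcs (elems S) (elems T)))
    sum-injections≈sum-funcs z col S T = begin
      sum (map (term z) (injections S T))                    ≈⟨ +-identityʳ _ ⟨
      sum (map (term z) (injections S T)) + 0#               ≈⟨ +-congˡ non-injective≈0 ⟨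
      sum (map (term z) (injections S T)) +
        sum (map (term z) (filter (¬? ∘ injective?) F))      ≈⟨ sum-partition injective? (term z) F ⟨
      sum (map (term z) F)                                   ∎
      where
      F : List (List (Fin n × Fin n))
      F = funcs (elems S) (elems T)
      injective? : Decidable (λ (g : List (Fin n × Fin n)) → Unique (map proj₂ g))
      injective? g = unique? (map proj₂ g)
      non-injective≈0 : sum (map (term z) (filter (¬? ∘ injective?) F)) ≈ 0#
      non-injective≈0 =
        sum-≈0 (term z) (All.map (term≈0-if-non-injective z col _) (all-filter (¬? ∘ injective?) F))

    sum-elems≈-sum-elems-∁ : (f : Fin n → Carrier) → sum (map f (allFin n)) ≈ 0# → (T : Subset n) →
                             sum (map f (elems T)) ≈ sum (map (λ j → - f j) (elems (∁ T)))
    sum-elems≈-sum-elems-∁ f sum≈0 T = begin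
      sum (map f (elems T))                             ≈⟨ +-inverseˡ-unique _ _ split-sum≈0 ⟩
      - sum (map f (filter (¬? ∘ (_∈? T)) (allFin n)))  ≡⟨ ≡.cong (λ js → - sum (map f js)) ∉T≡∈∁T ⟩
      - sum (map f (elems (∁ T)))                       ≈⟨ -‿sum f (elems (∁ T)) ⟩
      sum (map (λ j → - f j) (elems (∁ T)))             ∎
      where
      split-sum≈0 : sum (map f (elems T)) + sum (map f (filter (¬? ∘ (_∈? T)) (allFin n))) ≈ 0#
      split-sum≈0 = trans (sym (sum-partition (_∈? T) f (allFin n))) sum≈0
      ∉T≡∈∁T : filter (¬? ∘ (_∈? T)) (allFin n) ≡.≡ elems (∁ T)
      ∉T≡∈∁T = filter-≐ (¬? ∘ (_∈? T)) (_∈? ∁ T) (x∉p⇒x∈∁p , x∈∁p⇒x∉p) (allFin n)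

    injection-sum≈0 : (z : Fin n → Fin n → Carrier) → (∀ i i' j → z i j * z i' j ≈ 0#) →
                      (∀ i → sum (map (z i) (allFin n)) ≈ 0#) →
                      (S T : Subset n) → ∣ ∁ T ∣ < ∣ S ∣ → sum (map (term z) (injections S T)) ≈ 0#
    injection-sum≈0 z col row S T ∣∁T∣<∣S∣ = begin
      sum (map (term z) (injections S T))                          ≈⟨ sum-injections≈sum-funcs z col S T ⟩
      sum (map (term z) (funcs (elems S) (elems T)))               ≈⟨ prod-sum≈sum-funcs z (elems S) (elems T) ⟨
      prod (map (λ i → sum (map (z i) (elems T))) (elems S))       ≈⟨ prod-cong row-sum-complement (elems S) ⟩
      prod (map (λ i → sum (map (-z i) (elems (∁ T)))) (elems S))  ≈⟨ prod-sum≈sum-funcs -z (elems S) (elems (∁ T)) ⟩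
      sum (map (term -z) (funcs (elems S) (elems (∁ T))))          ≈⟨ sum-≈0 (term -z) every-term≈0 ⟩
      0#                                                           ∎
      where
      -z : Fin n → Fin n → Carrier
      -z i j = - z i j
      -col : ∀ i i' j → -z i j * -z i' j ≈ 0#
      -col i i' j = begin
        - z i j * - z i' j      ≈⟨ -‿distribˡ-* _ _ ⟨
        - (z i j * - z i' j)    ≈⟨ -‿cong (-‿distribʳ-* _ _) ⟨
        - - (z i j * z i' j)    ≈⟨ -‿involutive _ ⟩
        z i j * z i' j          ≈⟨ col i i' j ⟩
        0#                      ∎
      row-sum-complement : ∀ i → sum (map (z i) (elems T)) ≈ sum (map (-z i) (elems (∁ T)))
      row-sum-complement i = sum-elems≈-sum-elems-∁ (z i) (row i) T
      every-term≈0 : All (λ g → term -z g ≈ 0#) (funcs (elems S) (elems (∁ T)))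
      every-term≈0 = All.map (term≈0-if-non-injective -z -col _) (funcs-non-injective S (∁ T) ∣∁T∣<∣S∣)

open import Data.Nat using (_+_)

lemma3p1 : {c ℓ : Level} (F : CommutativeRing c ℓ) → IsField F → (n : ℕ) → n ≥ 1 →
    (S T : Subset n) → ∣ S ∣ + ∣ T ∣ > n →
    Matrix._∈I F n (Matrix.a F n S T) × Matrix._∈I F n (Matrix.b F n S T)
lemma3p1 F _ n _ S T ∣S∣+∣T∣>n = a∈I , b∈I
  where
  open Matrix F n
  open QuotientRing F (Fin n × Fin n) Gen
    using (quotientRing; _≈I_; InIdeal-generator; InIdeal⇒≈I0; ≈I0⇒InIdeal)
  open Injections F n using (injection-sum≈0)
  open CommutativeRing F using (0#)

  generator≈I0 : ∀ {p} → Gen p → p ≈I con 0#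
  generator≈I0 = InIdeal⇒≈I0 ∘ InIdeal-generator

  ∣∁T∣<∣S∣ : ∣ ∁ T ∣ < ∣ S ∣
  ∣∁T∣<∣S∣ = ∣∁q∣<∣p∣ S T ∣S∣+∣T∣>n

  a∈I : a S T ∈I
  a∈I = ≈I0⇒InIdeal (injection-sum≈0 quotientRing x
          (λ i i' j → generator≈I0 (colProd i i' j)) (generator≈I0 ∘ rowSum) S T ∣∁T∣<∣S∣)

  b∈I : b S T ∈I
  b∈I = ≈I0⇒InIdeal (injection-sum≈0 quotientRing (λ i j → x j i)
          (λ i i' j → generator≈I0 (rowProd j i i')) (generator≈I0 ∘ colSum) S T ∣∁T∣<∣S∣)
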